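{- Let $n\ge1$, $0\le r\le n+1$, and let $G^r_n$ be any graph obtained from the linear crossed polyomino chain $G_n$ by deleting $r$ of its vertical edges. Then $$K\!f(G^r_n)=\frac{(n+1)(n^2+4n+r-2d+16)}{6},$$ where $d=d_1+d_{n+1}$ and $d_1,d_{n+1}$ are the degrees of vertices $1$ and $n+1$ in $G^r_n$.
   Context: For $n\geq1$, $G_n$ is the simple graph with vertex set $\{1,\ldots,n+1\}\cup\{1',\ldots,(n+1)'\}$ and edge set consisting of the vertical edges $ii'$ for $1\le i\le n+1$ together with, for each $1\le i\le n$, the edges $i(i+1)$, $i'(i+1)'$, $i(i+1)'$, $i'(i+1)$. For $0\le r\le n+1$, $\mathcal{G}^r_n$ is the set of graphs obtained from $G_n$ by deleting exactly $r$ of the vertical edges $ii'$. The Kirchhoff index is $K\!f(G)=\sum_{\{u,v\}}r_{uv}$, summed over unordered pairs of distinct vertices, where $r_{uv}$ is the effective resistance between $u$ and $v$ when every edge is a unit resistor. -}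

module Defs where

open import Data.Bool using (Bool; true; false; if_then_else_; _∧_; _∨_; not)
open import Data.Nat as ℕ using (ℕ; zero; suc; _≡ᵇ_; _<ᵇ_)
open import Data.Fin using (Fin; toℕ; fromℕ)
open import Data.Fin.Subset using (Subset)
open import Data.Vec using (lookup)
open import Data.Integer as ℤ using (ℤ; +_)
open import Data.Rational using (ℚ; 0ℚ; 1ℚ; _+_; _-_; _/_)
open import Data.Product using (Σ; _×_; _,_)
open import Relation.Binary.PropositionalEquality using (_≡_)

-- Vertices of G_n (with n+1 columns): (false , i) is the top vertex i+1,
-- (true , i) is the bottom vertex (i+1)'.
V : ℕ → Set
V n = Bool × Fin (suc n)

_==B_ : Bool → Bool → Bool
true ==B true = true
false ==B false = true
_ ==B _ = false

eqV : ∀ {n} → V n → V n → Bool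
eqV (a , i) (b , j) = (a ==B b) ∧ (toℕ i ≡ᵇ toℕ j)

consec : ∀ {n} → Fin (suc n) → Fin (suc n) → Bool
consec i j = (suc (toℕ i) ≡ᵇ toℕ j) ∨ (suc (toℕ j) ≡ᵇ toℕ i)

-- Adjacency in the graph obtained from G_n by deleting the vertical edges
-- ii' for those columns i with  lookup S i = true .
adj : ∀ {n} → Subset (suc n) → V n → V n → Bool
adj S (a , i) (b , j) =
  consec i j ∨ (not (a ==B b) ∧ ((toℕ i ≡ᵇ toℕ j) ∧ not (lookup S i)))

ΣFin : ∀ {m} → (Fin m → ℚ) → ℚ
ΣFin {zero} f = 0ℚ
ΣFin {suc m} f = f Fin.zero + ΣFin (λ i → f (Fin.suc i))

ΣV : ∀ {n} → (V n → ℚ) → ℚ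
ΣV f = ΣFin (λ i → f (false , i)) + ΣFin (λ i → f (true , i))

ΣFinℕ : ∀ {m} → (Fin m → ℕ) → ℕ
ΣFinℕ {zero} f = 0
ΣFinℕ {suc m} f = f Fin.zero ℕ.+ ΣFinℕ (λ i → f (Fin.suc i))

deg : ∀ {n} → Subset (suc n) → V n → ℕ
deg S w = ΣFinℕ (λ i → if adj S w (false , i) then 1 else 0)
     ℕ.+ ΣFinℕ (λ i → if adj S w (true , i) then 1 else 0)

Lap : ∀ {n} → Subset (suc n) → (V n → ℚ) → V n → ℚ
Lap S x w = ΣV (λ v → if adj S w v then x w - x v else 0ℚ)

δ : ∀ {n} → V n → V n → ℚ
δ u w = if eqV u w then 1ℚ else 0ℚ

-- ρ is the effective resistance between u and v (unit resistors):
-- there is a potential x satisfying Kirchhoff's laws for a unit current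
-- entering at u and leaving at v, and ρ is the potential difference.
IsResistance : ∀ {n} → Subset (suc n) → V n → V n → ℚ → Set
IsResistance {n} S u v ρ =
  Σ (V n → ℚ) λ x → ((w : V n) → Lap S x w ≡ δ u w - δ v w) × (ρ ≡ x u - x v)

ResistanceFn : ∀ {n} → Subset (suc n) → (V n → V n → ℚ) → Set
ResistanceFn {n} S ρ = (u v : V n) → IsResistance S u v (ρ u v)

-- linear code of vertices used to sum over unordered pairs {u,v} (u ≠ v)
code : ∀ {n} → V n → ℕ
code (false , i) = toℕ i
code {n} (true , i) = suc n ℕ.+ toℕ i

Kf : ∀ {n} → (V n → V n → ℚ) → ℚ
Kf ρ = ΣV (λ u → ΣV (λ v → if code u <ᵇ code v then ρ u v else 0ℚ))

v1 : ∀ {n} → V n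
v1 = (false , Fin.zero)

vlast : ∀ {n} → V n
vlast {n} = (false , fromℕ n)

formula : ℕ → ℕ → ℕ → ℚ
formula n r d =
  ((+ (suc n ℕ.* (n ℕ.* n ℕ.+ 4 ℕ.* n ℕ.+ r ℕ.+ 16))) ℤ.- (+ (suc n ℕ.* (2 ℕ.* d)))) / 6

module Submission where

-- 1. Reciprocity.  For a symmetric adjacency the Laplacian is self-adjoint
--    (Green's identity), so any two potentials for the same unit current
--    u → v have the same difference x u - x v: resistances are unique.
-- 2. Explicit potentials.  Put d_t(k) = |k - t| and, for column i,
--    κ_i = 1 / (4 · (number of neighbouring columns + [rung i kept])).
--    For a unit current from u = (b,i₁) to v = (b',i₂) the function
--      x(a,i) = (d_{i₂}(i) - d_{i₁}(i)) / 8 + (σ_u(a,i) - σ_v(a,i)) · κ_i,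
--    where σ_u is +1 at u, -1 at the other end of u's rung and 0 elsewhere,
--    satisfies Kirchhoff's law: the path Laplacian of d_t is -2 at t plus
--    boundary terms, and κ_i exactly balances the degree of column i.
-- 3. Hence r((a,i),(b,j)) = |i-j| / 4 + (1 - σ_{(a,i)}(b,j)) (κ_i + κ_j).
-- 4. Summing: Kf = ½ Σ_{u,v} r(u,v) = ½ (Σ_{i,j} |i-j| + 8 (n+1) Σ_i κ_i),
--    and Σ_i κ_i only depends on |S| and on the end rungs, which also
--    determine the end degrees d₁, d_{n+1}.

module Resistance where

  open import Defs
  open import Data.Bool using (Bool; true; false; if_then_else_; _∧_; _∨_; not)
  open import Data.Bool.Properties using (∨-comm; ∧-zeroʳ)
  open import Data.Nat as ℕ using (ℕ; zero; suc; _≡ᵇ_; _<ᵇ_; ∣_-_∣; _∸_)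
  import Data.Nat.Properties as ℕP
  open import Data.Fin using (Fin; toℕ; fromℕ) renaming (zero to fzero; suc to fsuc)
  import Data.Fin.Properties as FinP
  open import Data.Fin.Subset using (Subset) renaming (∣_∣ to card)
  open import Data.Vec using (lookup; _∷_; [])
  import Data.Integer as ℤ
  import Data.Integer.Properties as ℤP
  open import Data.Rational using (ℚ; 0ℚ; 1ℚ; _+_; _*_; _-_; -_; _/_; toℚᵘ)
  open import Data.Rational.Properties
    using (+-identityˡ; +-identityʳ; +-assoc; *-identityˡ; *-identityʳ; *-zeroˡ; *-zeroʳ; *-comm; +-comm;
           toℚᵘ-homo-+; toℚᵘ-homo-*; toℚᵘ-homo‿-; fromℚᵘ-toℚᵘ; fromℚᵘ-cong)
  open import Data.Rational.Unnormalised as ℚᵘ using (mkℚᵘ; *≡*)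
  import Data.Rational.Unnormalised.Properties as ℚᵘP
  open import Data.Rational.Solver
  open import Data.Product using (_×_; _,_)
  open import Data.Sum using (_⊎_; inj₁; inj₂)
  open import Data.Empty using (⊥-elim)
  open import Relation.Nullary using (¬_; yes; no)
  open import Relation.Binary.Definitions using (tri<; tri≈; tri>)
  open import Relation.Binary.PropositionalEquality hiding ([_])
  open +-*-Solver

  ι : ℕ → ℚ
  ι zero = 0ℚ
  ι (suc n) = 1ℚ + ι n

  [_] : Bool → ℚ
  [ b ] = if b then 1ℚ else 0ℚ

  two four half third quarter sixth eighth twelfth twentyfourth : ℚ
  two = 1ℚ + 1ℚ
  four = two + two
  half = ℤ.+ 1 / 2
  third = ℤ.+ 1 / 3
  quarter = ℤ.+ 1 / 4
  sixth = ℤ.+ 1 / 6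
  eighth = ℤ.+ 1 / 8
  twelfth = ℤ.+ 1 / 12
  twentyfourth = ℤ.+ 1 / 24

  ι-+ : ∀ a b → ι (a ℕ.+ b) ≡ ι a + ι b
  ι-+ zero b = sym (+-identityˡ (ι b))
  ι-+ (suc a) b = trans (cong (1ℚ +_) (ι-+ a b)) (sym (+-assoc 1ℚ (ι a) (ι b)))

  ι-* : ∀ a b → ι (a ℕ.* b) ≡ ι a * ι b
  ι-* zero b = sym (*-zeroˡ (ι b))
  ι-* (suc a) b = trans (ι-+ b (a ℕ.* b)) (trans (cong (ι b +_) (ι-* a b))
    (solve 2 (λ x y → y :+ x :* y := (con 1ℚ :+ x) :* y) refl (ι a) (ι b)))

  ι-indicator : ∀ b → ι (if b then 1 else 0) ≡ [ b ]
  ι-indicator true = +-identityʳ 1ℚ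
  ι-indicator false = refl

  if-as-bracket : ∀ b (x : ℚ) → (if b then x else 0ℚ) ≡ [ b ] * x
  if-as-bracket true x = sym (*-identityˡ x)
  if-as-bracket false x = sym (*-zeroˡ x)

  bracket-times : ∀ b (x : ℚ) → x * [ b ] ≡ (if b then x else 0ℚ)
  bracket-times true x = *-identityʳ x
  bracket-times false x = *-zeroʳ x

  unless-as-bracket : ∀ b (x : ℚ) → (if b then 0ℚ else x) ≡ [ not b ] * x
  unless-as-bracket true x = sym (*-zeroˡ x)
  unless-as-bracket false x = sym (*-identityˡ x)

  bracket-not : ∀ b → [ not b ] ≡ 1ℚ - [ b ]
  bracket-not true = refl
  bracket-not false = refl

  ≡ᵇ-refl : ∀ m → (m ≡ᵇ m) ≡ true
  ≡ᵇ-refl zero = refl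
  ≡ᵇ-refl (suc m) = ≡ᵇ-refl m

  ≡ᵇ-false : ∀ m n → ¬ m ≡ n → (m ≡ᵇ n) ≡ false
  ≡ᵇ-false zero zero m≢n = ⊥-elim (m≢n refl)
  ≡ᵇ-false zero (suc n) _ = refl
  ≡ᵇ-false (suc m) zero _ = refl
  ≡ᵇ-false (suc m) (suc n) m≢n = ≡ᵇ-false m n (λ e → m≢n (cong suc e))

  ≡ᵇ-sym : ∀ m n → (m ≡ᵇ n) ≡ (n ≡ᵇ m)
  ≡ᵇ-sym zero zero = refl
  ≡ᵇ-sym zero (suc n) = refl
  ≡ᵇ-sym (suc m) zero = refl
  ≡ᵇ-sym (suc m) (suc n) = ≡ᵇ-sym m n

  <ᵇ-true : ∀ m n → m ℕ.< n → (m <ᵇ n) ≡ true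
  <ᵇ-true zero (suc n) _ = refl
  <ᵇ-true (suc m) (suc n) (ℕ.s≤s m<n) = <ᵇ-true m n m<n

  <ᵇ-false : ∀ m n → n ℕ.≤ m → (m <ᵇ n) ≡ false
  <ᵇ-false m zero _ = refl
  <ᵇ-false (suc m) (suc n) (ℕ.s≤s n≤m) = <ᵇ-false m n n≤m

  below-or-last : ∀ k n → k ℕ.≤ n →
    ((k <ᵇ n) ≡ true × (k ≡ᵇ n) ≡ false) ⊎ ((k <ᵇ n) ≡ false × (k ≡ᵇ n) ≡ true)
  below-or-last k n k≤n with ℕP.<-cmp k n
  ... | tri< k<n _ _ = inj₁ (<ᵇ-true k n k<n , ≡ᵇ-false k n (ℕP.<⇒≢ k<n))
  ... | tri≈ _ refl _ = inj₂ (<ᵇ-false k k ℕP.≤-refl , ≡ᵇ-refl k)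
  ... | tri> _ _ k>n = ⊥-elim (ℕP.<⇒≱ k>n k≤n)

  ΣFin-cong : ∀ {m} {f g : Fin m → ℚ} → (∀ i → f i ≡ g i) → ΣFin f ≡ ΣFin g
  ΣFin-cong {zero} f≗g = refl
  ΣFin-cong {suc m} f≗g = cong₂ _+_ (f≗g fzero) (ΣFin-cong (λ i → f≗g (fsuc i)))

  ΣFin-0 : ∀ m → ΣFin {m} (λ _ → 0ℚ) ≡ 0ℚ
  ΣFin-0 zero = refl
  ΣFin-0 (suc m) = cong (0ℚ +_) (ΣFin-0 m)

  ΣFin-+ : ∀ {m} (f g : Fin m → ℚ) → ΣFin (λ i → f i + g i) ≡ ΣFin f + ΣFin g
  ΣFin-+ {zero} f g = refl
  ΣFin-+ {suc m} f g = trans (cong (f fzero + g fzero +_) (ΣFin-+ (λ i → f (fsuc i)) (λ i → g (fsuc i))))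
    (solve 4 (λ a b c d → (a :+ b) :+ (c :+ d) := (a :+ c) :+ (b :+ d)) refl
      (f fzero) (g fzero) (ΣFin (λ i → f (fsuc i))) (ΣFin (λ i → g (fsuc i))))

  ΣFin-*ˡ : ∀ {m} (c : ℚ) (f : Fin m → ℚ) → ΣFin (λ i → c * f i) ≡ c * ΣFin f
  ΣFin-*ˡ {zero} c f = sym (*-zeroʳ c)
  ΣFin-*ˡ {suc m} c f = trans (cong (c * f fzero +_) (ΣFin-*ˡ c (λ i → f (fsuc i))))
    (solve 3 (λ c a b → c :* a :+ c :* b := c :* (a :+ b)) refl c (f fzero) (ΣFin (λ i → f (fsuc i))))

  ΣFin-*ʳ : ∀ {m} (f : Fin m → ℚ) (c : ℚ) → ΣFin (λ i → f i * c) ≡ ΣFin f * c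
  ΣFin-*ʳ f c = trans (ΣFin-cong (λ i → *-comm (f i) c)) (trans (ΣFin-*ˡ c f) (*-comm c (ΣFin f)))

  ΣFin-- : ∀ {m} (f g : Fin m → ℚ) → ΣFin (λ i → f i - g i) ≡ ΣFin f - ΣFin g
  ΣFin-- f g = trans (ΣFin-cong (λ i → solve 2 (λ a b → a :- b := a :+ con (- 1ℚ) :* b) refl (f i) (g i)))
    (trans (ΣFin-+ f (λ i → - 1ℚ * g i))
    (trans (cong (ΣFin f +_) (ΣFin-*ˡ (- 1ℚ) g))
    (solve 2 (λ a b → a :+ con (- 1ℚ) :* b := a :- b) refl (ΣFin f) (ΣFin g))))

  ΣFin-const : ∀ m (c : ℚ) → ΣFin {m} (λ _ → c) ≡ ι m * c
  ΣFin-const zero c = sym (*-zeroˡ c)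
  ΣFin-const (suc m) c = trans (cong (c +_) (ΣFin-const m c))
    (solve 2 (λ c x → c :+ x :* c := (con 1ℚ :+ x) :* c) refl c (ι m))

  ΣFin-swap : ∀ {m k} (f : Fin m → Fin k → ℚ) →
    ΣFin (λ i → ΣFin (λ j → f i j)) ≡ ΣFin (λ j → ΣFin (λ i → f i j))
  ΣFin-swap {zero} {k} f = sym (ΣFin-0 k)
  ΣFin-swap {suc m} f = trans (cong (ΣFin (f fzero) +_) (ΣFin-swap (λ i → f (fsuc i))))
    (sym (ΣFin-+ (f fzero) (λ j → ΣFin (λ i → f (fsuc i) j))))

  ΣFin-pick : ∀ {m} (i : Fin m) (g : Fin m → ℚ) →
    ΣFin (λ j → if toℕ i ≡ᵇ toℕ j then g j else 0ℚ) ≡ g i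
  ΣFin-pick {suc m} fzero g = trans (cong (g fzero +_) (ΣFin-0 m)) (+-identityʳ (g fzero))
  ΣFin-pick {suc m} (fsuc i) g = trans (cong (0ℚ +_) (ΣFin-pick i (λ j → g (fsuc j)))) (+-identityˡ (g (fsuc i)))

  ΣFin-count : ∀ {m} (S : Subset m) → ΣFin (λ i → [ lookup S i ]) ≡ ι (card S)
  ΣFin-count [] = refl
  ΣFin-count (true ∷ S) = cong (1ℚ +_) (ΣFin-count S)
  ΣFin-count (false ∷ S) = trans (cong (0ℚ +_) (ΣFin-count S)) (+-identityˡ _)

  ι-ΣFinℕ : ∀ {m} (f : Fin m → ℕ) → ι (ΣFinℕ f) ≡ ΣFin (λ i → ι (f i))
  ι-ΣFinℕ {zero} f = refl
  ι-ΣFinℕ {suc m} f = trans (ι-+ (f fzero) (ΣFinℕ (λ i → f (fsuc i)))) (cong (ι (f fzero) +_) (ι-ΣFinℕ (λ i → f (fsuc i))))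

  module _ {n : ℕ} where

    ΣV-cong : {f g : V n → ℚ} → (∀ w → f w ≡ g w) → ΣV f ≡ ΣV g
    ΣV-cong f≗g = cong₂ _+_ (ΣFin-cong (λ i → f≗g (false , i))) (ΣFin-cong (λ i → f≗g (true , i)))

    ΣV-+ : (f g : V n → ℚ) → ΣV (λ w → f w + g w) ≡ ΣV f + ΣV g
    ΣV-+ f g = trans (cong₂ _+_ (ΣFin-+ (λ i → f (false , i)) (λ i → g (false , i)))
                                (ΣFin-+ (λ i → f (true , i)) (λ i → g (true , i))))
      (solve 4 (λ a b c d → (a :+ b) :+ (c :+ d) := (a :+ c) :+ (b :+ d)) refl
        (ΣFin (λ i → f (false , i))) (ΣFin (λ i → g (false , i))) (ΣFin (λ i → f (true , i))) (ΣFin (λ i → g (true , i))))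

    ΣV-*ˡ : (c : ℚ) (f : V n → ℚ) → ΣV (λ w → c * f w) ≡ c * ΣV f
    ΣV-*ˡ c f = trans (cong₂ _+_ (ΣFin-*ˡ c (λ i → f (false , i))) (ΣFin-*ˡ c (λ i → f (true , i))))
      (solve 3 (λ c a b → c :* a :+ c :* b := c :* (a :+ b)) refl c (ΣFin (λ i → f (false , i))) (ΣFin (λ i → f (true , i))))

    ΣV-- : (f g : V n → ℚ) → ΣV (λ w → f w - g w) ≡ ΣV f - ΣV g
    ΣV-- f g = trans (cong₂ _+_ (ΣFin-- (λ i → f (false , i)) (λ i → g (false , i)))
                                (ΣFin-- (λ i → f (true , i)) (λ i → g (true , i))))
      (solve 4 (λ a b c d → (a :- b) :+ (c :- d) := (a :+ c) :- (b :+ d)) refl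
        (ΣFin (λ i → f (false , i))) (ΣFin (λ i → g (false , i))) (ΣFin (λ i → f (true , i))) (ΣFin (λ i → g (true , i))))

    ΣV-ΣFin-swap : ∀ {k} (f : V n → Fin k → ℚ) → ΣV (λ u → ΣFin (f u)) ≡ ΣFin (λ j → ΣV (λ u → f u j))
    ΣV-ΣFin-swap f = trans (cong₂ _+_ (ΣFin-swap (λ i → f (false , i))) (ΣFin-swap (λ i → f (true , i))))
      (sym (ΣFin-+ (λ j → ΣFin (λ i → f (false , i) j)) (λ j → ΣFin (λ i → f (true , i) j))))

    ΣV-swap : (f : V n → V n → ℚ) → ΣV (λ u → ΣV (λ v → f u v)) ≡ ΣV (λ v → ΣV (λ u → f u v))
    ΣV-swap f = trans (ΣV-+ (λ u → ΣFin (λ j → f u (false , j))) (λ u → ΣFin (λ j → f u (true , j))))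
      (cong₂ _+_ (ΣV-ΣFin-swap (λ u j → f u (false , j))) (ΣV-ΣFin-swap (λ u j → f u (true , j))))

    ΣV-pick : (x : V n → ℚ) (u : V n) → ΣV (λ w → x w * δ u w) ≡ x u
    ΣV-pick x (false , i) = begin
        ΣFin (λ j → x (false , j) * [ toℕ i ≡ᵇ toℕ j ]) + ΣFin (λ j → x (true , j) * 0ℚ)
      ≡⟨ cong₂ _+_ (ΣFin-cong (λ j → bracket-times (toℕ i ≡ᵇ toℕ j) (x (false , j))))
                   (trans (ΣFin-cong (λ j → *-zeroʳ (x (true , j)))) (ΣFin-0 (suc n))) ⟩
        ΣFin (λ j → if toℕ i ≡ᵇ toℕ j then x (false , j) else 0ℚ) + 0ℚ
      ≡⟨ trans (+-identityʳ _) (ΣFin-pick i (λ j → x (false , j))) ⟩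
        x (false , i)
      ∎
      where open ≡-Reasoning
    ΣV-pick x (true , i) = begin
        ΣFin (λ j → x (false , j) * 0ℚ) + ΣFin (λ j → x (true , j) * [ toℕ i ≡ᵇ toℕ j ])
      ≡⟨ cong₂ _+_ (trans (ΣFin-cong (λ j → *-zeroʳ (x (false , j)))) (ΣFin-0 (suc n)))
                   (ΣFin-cong (λ j → bracket-times (toℕ i ≡ᵇ toℕ j) (x (true , j)))) ⟩
        0ℚ + ΣFin (λ j → if toℕ i ≡ᵇ toℕ j then x (true , j) else 0ℚ)
      ≡⟨ trans (+-identityˡ _) (ΣFin-pick i (λ j → x (true , j))) ⟩
        x (true , i)
      ∎
      where open ≡-Reasoning

  Laplacian : ∀ {n} → (V n → V n → Bool) → (V n → ℚ) → V n → ℚ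
  Laplacian A x w = ΣV (λ v → if A w v then x w - x v else 0ℚ)

  guarded-times : ∀ b (x y z : ℚ) →
    x * (if b then y - z else 0ℚ) ≡ (if b then x * y else 0ℚ) - (if b then x * z else 0ℚ)
  guarded-times true x y z = solve 3 (λ x y z → x :* (y :- z) := x :* y :- x :* z) refl x y z
  guarded-times false x y z = *-zeroʳ x

  module _ {n : ℕ} (A : V n → V n → Bool) (A-sym : ∀ w v → A w v ≡ A v w) where

    -- ⟨x , L y⟩ = Σ_{w ~ v} x(w) y(w) - Σ_{w ~ v} x(w) y(v); both parts are
    -- symmetric in x and y, the second one because the adjacency is.
    degree-form edge-form : (V n → ℚ) → (V n → ℚ) → ℚ
    degree-form x y = ΣV (λ w → ΣV (λ v → if A w v then x w * y w else 0ℚ))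
    edge-form x y = ΣV (λ w → ΣV (λ v → if A w v then x w * y v else 0ℚ))

    laplacian-pairing : ∀ x y → ΣV (λ w → x w * Laplacian A y w) ≡ degree-form x y - edge-form x y
    laplacian-pairing x y = begin
        ΣV (λ w → x w * Laplacian A y w)
      ≡⟨ ΣV-cong (λ w → sym (ΣV-*ˡ (x w) (λ v → if A w v then y w - y v else 0ℚ))) ⟩
        ΣV (λ w → ΣV (λ v → x w * (if A w v then y w - y v else 0ℚ)))
      ≡⟨ ΣV-cong (λ w → trans (ΣV-cong (λ v → guarded-times (A w v) (x w) (y w) (y v)))
                                   (ΣV-- (λ v → if A w v then x w * y w else 0ℚ) (λ v → if A w v then x w * y v else 0ℚ))) ⟩
        ΣV (λ w → ΣV (λ v → if A w v then x w * y w else 0ℚ) - ΣV (λ v → if A w v then x w * y v else 0ℚ))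
      ≡⟨ ΣV-- (λ w → ΣV (λ v → if A w v then x w * y w else 0ℚ)) (λ w → ΣV (λ v → if A w v then x w * y v else 0ℚ)) ⟩
        degree-form x y - edge-form x y
      ∎
      where open ≡-Reasoning

    degree-form-sym : ∀ x y → degree-form x y ≡ degree-form y x
    degree-form-sym x y = ΣV-cong (λ w → ΣV-cong (λ v → cong (if A w v then_else 0ℚ) (*-comm (x w) (y w))))

    edge-form-sym : ∀ x y → edge-form x y ≡ edge-form y x
    edge-form-sym x y = trans (ΣV-swap (λ w v → if A w v then x w * y v else 0ℚ))
      (ΣV-cong (λ v → ΣV-cong (λ w → flip v w)))
      where
      flip : ∀ v w → (if A w v then x w * y v else 0ℚ) ≡ (if A v w then y v * x w else 0ℚ)
      flip v w rewrite A-sym w v = cong (if A v w then_else 0ℚ) (*-comm (x w) (y v))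

    green : ∀ x y → ΣV (λ w → x w * Laplacian A y w) ≡ ΣV (λ w → y w * Laplacian A x w)
    green x y = trans (laplacian-pairing x y)
      (trans (cong₂ _-_ (degree-form-sym x y) (edge-form-sym x y)) (sym (laplacian-pairing y x)))

    -- Testing the equation L x = δ_u - δ_v against another solution y
    -- shows that all solutions have the same potential difference.
    potential-difference-unique : ∀ u v (x y : V n → ℚ) →
      (∀ w → Laplacian A x w ≡ δ u w - δ v w) → (∀ w → Laplacian A y w ≡ δ u w - δ v w) →
      x u - x v ≡ y u - y v
    potential-difference-unique u v x y Lx Ly = begin
        x u - x v
      ≡⟨ sym (trans (ΣV-- (λ w → x w * δ u w) (λ w → x w * δ v w)) (cong₂ _-_ (ΣV-pick x u) (ΣV-pick x v))) ⟩
        ΣV (λ w → x w * δ u w - x w * δ v w)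
      ≡⟨ ΣV-cong (λ w → trans (factor (x w) (δ u w) (δ v w)) (cong (x w *_) (sym (Ly w)))) ⟩
        ΣV (λ w → x w * Laplacian A y w)
      ≡⟨ green x y ⟩
        ΣV (λ w → y w * Laplacian A x w)
      ≡⟨ ΣV-cong (λ w → trans (cong (y w *_) (Lx w)) (sym (factor (y w) (δ u w) (δ v w)))) ⟩
        ΣV (λ w → y w * δ u w - y w * δ v w)
      ≡⟨ trans (ΣV-- (λ w → y w * δ u w) (λ w → y w * δ v w)) (cong₂ _-_ (ΣV-pick y u) (ΣV-pick y v)) ⟩
        y u - y v
      ∎
      where
      open ≡-Reasoning
      factor : ∀ a b c → a * b - a * c ≡ a * (b - c)
      factor = solve 3 (λ a b c → a :* b :- a :* c := a :* (b :- c)) refl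

  ==B-sym : ∀ a b → (a ==B b) ≡ (b ==B a)
  ==B-sym true true = refl
  ==B-sym true false = refl
  ==B-sym false true = refl
  ==B-sym false false = refl

  consec-sym : ∀ {n} (i j : Fin (suc n)) → consec i j ≡ consec j i
  consec-sym i j = ∨-comm (suc (toℕ i) ≡ᵇ toℕ j) (suc (toℕ j) ≡ᵇ toℕ i)

  consec-distinct : ∀ k j → ((suc k ≡ᵇ j) ∨ (suc j ≡ᵇ k)) ≡ true → (k ≡ᵇ j) ≡ false
  consec-distinct zero zero ()
  consec-distinct zero (suc j) _ = refl
  consec-distinct (suc k) zero _ = refl
  consec-distinct (suc k) (suc j) c = consec-distinct k j c

  -- The two vertices (false , j) and (true , j) of one column, seen from a
  -- vertex (a , i): both are neighbours if the columns are consecutive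
  -- (c = true), the partner of a is one if the column is the same
  -- (e = true) and the rung is kept (s = false).
  column-contribution : ∀ (c e s a : Bool) (h : Bool → ℚ) → (c ≡ true → e ≡ false) →
    (if c ∨ (not (a ==B false) ∧ (e ∧ not s)) then h false else 0ℚ)
      + (if c ∨ (not (a ==B true) ∧ (e ∧ not s)) then h true else 0ℚ)
    ≡ (if c then h false + h true else 0ℚ) + (if e then (if s then 0ℚ else h (not a)) else 0ℚ)
  column-contribution true false s a h _ = sym (+-identityʳ _)
  column-contribution true true s a h c⇒¬e with c⇒¬e refl
  ... | ()
  column-contribution false false s false h _ = refl
  column-contribution false false s true h _ = refl
  column-contribution false true true false h _ = refl
  column-contribution false true true true h _ = refl
  column-contribution false true false false h _ = refl
  column-contribution false true false true h _ = trans (+-identityʳ (h false)) (sym (+-identityˡ (h false)))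

  neighbour-sum : ∀ m k (G : ℕ → ℚ) → k ℕ.< m →
    ΣFin {m} (λ j → if (suc k ≡ᵇ toℕ j) ∨ (suc (toℕ j) ≡ᵇ k) then G (toℕ j) else 0ℚ)
    ≡ (if k ≡ᵇ 0 then 0ℚ else G (k ∸ 1)) + (if suc k <ᵇ m then G (suc k) else 0ℚ)
  neighbour-sum (suc zero) zero G _ = refl
  neighbour-sum (suc (suc m)) zero G _ = cong (0ℚ +_) (trans (cong (G 1 +_) (ΣFin-0 m)) (+-identityʳ (G 1)))
  neighbour-sum (suc m) (suc zero) G (ℕ.s≤s 0<m) =
    cong (G 0 +_) (trans (neighbour-sum m zero (λ j → G (suc j)) 0<m) (+-identityˡ _))
  neighbour-sum (suc m) (suc (suc k)) G (ℕ.s≤s k+1<m) =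
    trans (+-identityˡ _) (neighbour-sum m (suc k) (λ j → G (suc j)) k+1<m)

  module _ {n : ℕ} (S : Subset (suc n)) where

    adj-sym : ∀ w v → adj S w v ≡ adj S v w
    adj-sym (a , i) (b , j) with i FinP.≟ j
    ... | yes refl rewrite ==B-sym a b = refl
    ... | no i≢j rewrite ≡ᵇ-false (toℕ i) (toℕ j) (λ e → i≢j (FinP.toℕ-injective e))
                       | ≡ᵇ-false (toℕ j) (toℕ i) (λ e → i≢j (FinP.toℕ-injective (sym e)))
                       | consec-sym i j | ∧-zeroʳ (not (a ==B b)) | ∧-zeroʳ (not (b ==B a)) = refl

    resistance-unique : ∀ {u v ρ ρ′} → IsResistance S u v ρ → IsResistance S u v ρ′ → ρ ≡ ρ′
    resistance-unique {u} {v} (x , Lx , ρ≡) (y , Ly , ρ′≡) =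
      trans ρ≡ (trans (potential-difference-unique (adj S) adj-sym u v x y Lx Ly) (sym ρ′≡))

    neighbourhood-sum : (a : Bool) (i : Fin (suc n)) (h : V n → ℚ) (G : ℕ → ℚ) →
      (∀ j → h (false , j) + h (true , j) ≡ G (toℕ j)) →
      ΣV (λ v → if adj S (a , i) v then h v else 0ℚ)
        ≡ [ not (toℕ i ≡ᵇ 0) ] * G (toℕ i ∸ 1) + [ toℕ i <ᵇ n ] * G (suc (toℕ i))
          + [ not (lookup S i) ] * h (not a , i)
    neighbourhood-sum a i h G column≡G = begin
        ΣV (λ v → if adj S (a , i) v then h v else 0ℚ)
      ≡⟨ sym (ΣFin-+ (λ j → if adj S (a , i) (false , j) then h (false , j) else 0ℚ)
                     (λ j → if adj S (a , i) (true , j) then h (true , j) else 0ℚ)) ⟩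
        ΣFin (λ j → (if adj S (a , i) (false , j) then h (false , j) else 0ℚ)
                  + (if adj S (a , i) (true , j) then h (true , j) else 0ℚ))
      ≡⟨ ΣFin-cong (λ j → column-contribution (consec i j) (k ≡ᵇ toℕ j) s a (λ b → h (b , j))
                                             (consec-distinct k (toℕ j))) ⟩
        ΣFin (λ j → horizontal j + rung j)
      ≡⟨ ΣFin-+ horizontal rung ⟩
        ΣFin horizontal + ΣFin rung
      ≡⟨ cong₂ _+_ (trans (ΣFin-cong (λ j → cong (if consec i j then_else 0ℚ) (column≡G j)))
                          (neighbour-sum (suc n) k G (ℕ.s≤s (FinP.toℕ≤pred[n] i))))
                   (ΣFin-pick i (λ j → if s then 0ℚ else h (not a , j))) ⟩
        ((if k ≡ᵇ 0 then 0ℚ else G (k ∸ 1)) + (if k <ᵇ n then G (suc k) else 0ℚ))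
          + (if s then 0ℚ else h (not a , i))
      ≡⟨ cong₂ _+_ (cong₂ _+_ (unless-as-bracket (k ≡ᵇ 0) (G (k ∸ 1))) (if-as-bracket (k <ᵇ n) (G (suc k))))
                   (unless-as-bracket s (h (not a , i))) ⟩
        [ not (k ≡ᵇ 0) ] * G (k ∸ 1) + [ k <ᵇ n ] * G (suc k) + [ not s ] * h (not a , i)
      ∎
      where
      open ≡-Reasoning
      k : ℕ
      k = toℕ i
      s : Bool
      s = lookup S i
      horizontal rung : Fin (suc n) → ℚ
      horizontal j = if consec i j then h (false , j) + h (true , j) else 0ℚ
      rung j = if k ≡ᵇ toℕ j then (if s then 0ℚ else h (not a , j)) else 0ℚ

    degree : ∀ a i → ι (deg S (a , i))
      ≡ [ not (toℕ i ≡ᵇ 0) ] * two + [ toℕ i <ᵇ n ] * two + [ not (lookup S i) ] * 1ℚ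
    degree a i = trans (ι-+ (ΣFinℕ (indicator false)) (ΣFinℕ (indicator true)))
      (trans (cong₂ _+_ (trans (ι-ΣFinℕ (indicator false)) (ΣFin-cong (λ j → ι-indicator (adj S (a , i) (false , j)))))
                        (trans (ι-ΣFinℕ (indicator true)) (ΣFin-cong (λ j → ι-indicator (adj S (a , i) (true , j))))))
             (neighbourhood-sum a i (λ _ → 1ℚ) (λ _ → two) (λ _ → refl)))
      where
      indicator : Bool → Fin (suc n) → ℕ
      indicator b j = if adj S (a , i) (b , j) then 1 else 0

    degree-first : 1 ℕ.≤ n → ι (deg S v1) ≡ two + [ not (lookup S fzero) ]
    degree-first n≥1 = trans (degree false fzero)
      (trans (cong (λ b → [ false ] * two + [ b ] * two + [ not s ] * 1ℚ) (<ᵇ-true 0 n n≥1))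
             (solve 1 (λ x → con 0ℚ :* con two :+ con 1ℚ :* con two :+ x :* con 1ℚ := con two :+ x) refl [ not s ]))
      where
      s : Bool
      s = lookup S fzero

    degree-last : 1 ℕ.≤ n → ι (deg S vlast) ≡ two + [ not (lookup S (fromℕ n)) ]
    degree-last n≥1 = trans (degree false (fromℕ n))
      (trans (cong (λ k → [ not (k ≡ᵇ 0) ] * two + [ k <ᵇ n ] * two + [ not s ] * 1ℚ) (FinP.toℕ-fromℕ n))
      (trans (cong₂ (λ b c → [ not b ] * two + [ c ] * two + [ not s ] * 1ℚ)
                    (≡ᵇ-false n 0 (λ n≡0 → ℕP.<⇒≢ n≥1 (sym n≡0))) (<ᵇ-false n n ℕP.≤-refl))
             (solve 1 (λ x → con 1ℚ :* con two :+ con 0ℚ :* con two :+ x :* con 1ℚ := con two :+ x) refl [ not s ])))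
      where
      s : Bool
      s = lookup S (fromℕ n)

  dist : ℕ → ℕ → ℚ
  dist t k = ι ∣ k - t ∣

  pathLaplacian : ℕ → (ℕ → ℚ) → ℕ → ℚ
  pathLaplacian n f k = [ not (k ≡ᵇ 0) ] * (f k - f (k ∸ 1)) + [ k <ᵇ n ] * (f k - f (suc k))

  pathLaplacian-linear : ∀ n f g c k →
    pathLaplacian n (λ m → (f m - g m) * c) k ≡ (pathLaplacian n f k - pathLaplacian n g k) * c
  pathLaplacian-linear n f g c k =
    solve 9 (λ b₀ b₁ f₀ f₋ f₊ g₀ g₋ g₊ c →
               b₀ :* ((f₀ :- g₀) :* c :- (f₋ :- g₋) :* c) :+ b₁ :* ((f₀ :- g₀) :* c :- (f₊ :- g₊) :* c)
            := ((b₀ :* (f₀ :- f₋) :+ b₁ :* (f₀ :- f₊)) :- (b₀ :* (g₀ :- g₋) :+ b₁ :* (g₀ :- g₊))) :* c)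
      refl [ not (k ≡ᵇ 0) ] [ k <ᵇ n ] (f k) (f (k ∸ 1)) (f (suc k)) (g k) (g (k ∸ 1)) (g (suc k)) c

  slope : ℕ → ℕ → ℚ
  slope k t = if k <ᵇ t then - 1ℚ else 1ℚ

  dist-step : ∀ k t → dist t (suc k) ≡ dist t k + slope k t
  dist-step k zero rewrite ℕP.∣-∣-identityʳ k = +-comm 1ℚ (ι k)
  dist-step zero (suc t) = solve 1 (λ a → a := (con 1ℚ :+ a) :+ con (- 1ℚ)) refl (ι t)
  dist-step (suc k) (suc t) = dist-step k t

  slope-change : ∀ n t k → t ℕ.≤ suc n → k ℕ.≤ n →
    slope k t - [ k <ᵇ n ] * slope (suc k) t ≡ - two * [ suc k ≡ᵇ t ] + 0ℚ + [ k ≡ᵇ n ]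
  slope-change n t k t≤ k≤ with ℕP.<-cmp (suc k) t
  ... | tri< k+1<t _ _ rewrite <ᵇ-true k t (ℕP.<⇒≤ k+1<t) | <ᵇ-true (suc k) t k+1<t
          | <ᵇ-true k n (ℕ.s≤s⁻¹ (ℕP.≤-trans k+1<t t≤)) | ≡ᵇ-false (suc k) t (ℕP.<⇒≢ k+1<t)
          | ≡ᵇ-false k n (ℕP.<⇒≢ (ℕ.s≤s⁻¹ (ℕP.≤-trans k+1<t t≤))) = refl
  ... | tri≈ _ refl _ rewrite <ᵇ-true k (suc k) (ℕP.n<1+n k) | <ᵇ-false (suc k) (suc k) ℕP.≤-refl | ≡ᵇ-refl k
          with below-or-last k n k≤
  ...   | inj₁ (p , q) rewrite p | q = refl
  ...   | inj₂ (p , q) rewrite p | q = refl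
  slope-change n t k t≤ k≤ | tri> _ k+1≢t k+1>t rewrite <ᵇ-false k t (ℕ.s≤s⁻¹ k+1>t) | <ᵇ-false (suc k) t (ℕP.<⇒≤ k+1>t)
          | ≡ᵇ-false (suc k) t k+1≢t
          with below-or-last k n k≤
  ...   | inj₁ (p , q) rewrite p | q = refl
  ...   | inj₂ (p , q) rewrite p | q = refl

  pathLaplacian-dist : ∀ n t k → 1 ℕ.≤ n → t ℕ.≤ n → k ℕ.≤ n →
    pathLaplacian n (dist t) k ≡ - two * [ k ≡ᵇ t ] + [ k ≡ᵇ 0 ] + [ k ≡ᵇ n ]
  pathLaplacian-dist (suc n) zero zero _ _ _ = refl
  pathLaplacian-dist (suc n) (suc t) zero _ _ _ =
    solve 1 (λ a → con 0ℚ :* ((con 1ℚ :+ a) :- (con 1ℚ :+ a)) :+ con 1ℚ :* ((con 1ℚ :+ a) :- a)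
                 := con (- two) :* con 0ℚ :+ con 1ℚ :+ con 0ℚ) refl (ι t)
  pathLaplacian-dist (suc n) t (suc k) _ t≤ k≤ = trans by-slopes (slope-change n t k t≤ (ℕ.s≤s⁻¹ k≤))
    where
    by-slopes : 1ℚ * (dist t (suc k) - dist t k) + [ k <ᵇ n ] * (dist t (suc k) - dist t (suc (suc k)))
              ≡ slope k t - [ k <ᵇ n ] * slope (suc k) t
    by-slopes = trans (cong₂ (λ x y → 1ℚ * (x - dist t k) + [ k <ᵇ n ] * (x - y))
                             (dist-step k t) (trans (dist-step (suc k) t) (cong (_+ slope (suc k) t) (dist-step k t))))
      (solve 4 (λ d s₁ s₂ b → con 1ℚ :* ((d :+ s₁) :- d) :+ b :* ((d :+ s₁) :- ((d :+ s₁) :+ s₂)) := s₁ :- b :* s₂)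
             refl (dist t k) (slope k t) (slope (suc k) t) [ k <ᵇ n ])

  -- The weight κ of a column: e says whether it is an end column, s whether
  -- its rung is deleted.  It is 1 / (4 · (neighbouring columns + [rung kept])).

  columnWeight : Bool → Bool → ℚ
  columnWeight e s = if s then (if e then quarter else eighth) else (if e then eighth else twelfth)

  columnWeight-balance : ∀ n k s → 1 ℕ.≤ n → k ℕ.≤ n →
    columnWeight ((k ≡ᵇ 0) ∨ (k ≡ᵇ n)) s * ([ not (k ≡ᵇ 0) ] + [ k <ᵇ n ] + [ not s ]) ≡ quarter
  columnWeight-balance (suc n) zero true _ _ = refl
  columnWeight-balance (suc n) zero false _ _ = refl
  columnWeight-balance (suc n) (suc k) s _ k≤ with below-or-last k n (ℕ.s≤s⁻¹ k≤) | s
  ... | inj₁ (p , q) | true rewrite p | q = refl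
  ... | inj₁ (p , q) | false rewrite p | q = refl
  ... | inj₂ (p , q) | true rewrite p | q = refl
  ... | inj₂ (p , q) | false rewrite p | q = refl

  -- The rung sign σ: seen from a source in row b, a vertex in row a of the
  -- same column (e = true) gets +1 if it is the source and -1 if it is the
  -- other end of the rung; other columns get 0.

  rungSign : Bool → Bool → Bool → ℚ
  rungSign e b a = if e then (if b ==B a then 1ℚ else - 1ℚ) else 0ℚ

  rungSign-flip : ∀ e b a → rungSign e b (not a) ≡ - rungSign e b a
  rungSign-flip true true true = refl
  rungSign-flip true true false = refl
  rungSign-flip true false true = refl
  rungSign-flip true false false = refl
  rungSign-flip false b a = refl

  rungSign-self : ∀ m b → rungSign (m ≡ᵇ m) b b ≡ 1ℚ
  rungSign-self m true rewrite ≡ᵇ-refl m = refl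
  rungSign-self m false rewrite ≡ᵇ-refl m = refl

  rungSign-sym : ∀ m k a b → rungSign (m ≡ᵇ k) a b ≡ rungSign (k ≡ᵇ m) b a
  rungSign-sym m k a b rewrite ≡ᵇ-sym m k | ==B-sym a b = refl

  δ-as-rungSign : ∀ e b a → (if (b ==B a) ∧ e then 1ℚ else 0ℚ) ≡ ([ e ] + rungSign e b a) * half
  δ-as-rungSign true true true = refl
  δ-as-rungSign true true false = refl
  δ-as-rungSign true false true = refl
  δ-as-rungSign true false false = refl
  δ-as-rungSign false true true = refl
  δ-as-rungSign false true false = refl
  δ-as-rungSign false false true = refl
  δ-as-rungSign false false false = refl

  module Potential {n : ℕ} (S : Subset (suc n)) where

    κ : Fin (suc n) → ℚ
    κ i = columnWeight ((toℕ i ≡ᵇ 0) ∨ (toℕ i ≡ᵇ n)) (lookup S i)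

    σ : V n → V n → ℚ
    σ (b , i) (a , j) = rungSign (toℕ i ≡ᵇ toℕ j) b a

    column : V n → ℕ
    column (a , i) = toℕ i

    drift : V n → V n → ℕ → ℚ
    drift u v k = (dist (column v) k - dist (column u) k) * eighth

    potential : V n → V n → V n → ℚ
    potential u v (a , i) = drift u v (toℕ i) + (σ u (a , i) - σ v (a , i)) * κ i

    -- The rung terms of the two vertices of a column cancel: seen from any
    -- value y, the column j only contributes through the drift.
    column-pair : ∀ u v (y : ℚ) j →
      (y - potential u v (false , j)) + (y - potential u v (true , j)) ≡ two * (y - drift u v (toℕ j))
    column-pair u@(b₁ , i₁) v@(b₂ , i₂) y j =
      trans (cong₂ (λ p q → (y - potential u v (false , j)) + (y - (drift u v (toℕ j) + (p - q) * κ j)))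
                   (rungSign-flip (toℕ i₁ ≡ᵇ toℕ j) b₁ false) (rungSign-flip (toℕ i₂ ≡ᵇ toℕ j) b₂ false))
            (solve 5 (λ Y P A B K → (Y :- (P :+ (A :- B) :* K)) :+ (Y :- (P :+ ((:- A) :- (:- B)) :* K))
                                   := con two :* (Y :- P)) refl
               y (drift u v (toℕ j)) (σ u (false , j)) (σ v (false , j)) (κ j))

    rung-partner : ∀ u v a i →
      potential u v (not a , i) ≡ drift u v (toℕ i) + (- (σ u (a , i) - σ v (a , i))) * κ i
    rung-partner u@(b₁ , i₁) v@(b₂ , i₂) a i =
      trans (cong₂ (λ p q → drift u v (toℕ i) + (p - q) * κ i)
                   (rungSign-flip (toℕ i₁ ≡ᵇ toℕ i) b₁ a) (rungSign-flip (toℕ i₂ ≡ᵇ toℕ i) b₂ a))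
            (cong (λ c → drift u v (toℕ i) + c * κ i)
                  (solve 2 (λ p q → (:- p) :- (:- q) := :- (p :- q)) refl (σ u (a , i)) (σ v (a , i))))

    δ-as-σ : ∀ w a i → δ w (a , i) ≡ ([ toℕ i ≡ᵇ column w ] + σ w (a , i)) * half
    δ-as-σ (b , j) a i = trans (δ-as-rungSign (toℕ j ≡ᵇ toℕ i) b a)
                               (cong (λ e → ([ e ] + σ (b , j) (a , i)) * half) (≡ᵇ-sym (toℕ j) (toℕ i)))

    -- At a vertex (a , i), the Laplacian of the potential splits into the
    -- path Laplacian of the drift and the rung term, which κ balances.
    laplacian-split : ∀ (b₀ b₁ b₂ p p₋ p₊ τ k : ℚ) →
      b₀ * (two * ((p + τ * k) - p₋)) + b₁ * (two * ((p + τ * k) - p₊)) + b₂ * ((p + τ * k) - (p + (- τ) * k))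
      ≡ two * (b₀ * (p - p₋) + b₁ * (p - p₊)) + two * τ * (k * (b₀ + b₁ + b₂))
    laplacian-split = solve 8 (λ b₀ b₁ b₂ p p₋ p₊ τ k →
        b₀ :* (con two :* ((p :+ τ :* k) :- p₋)) :+ b₁ :* (con two :* ((p :+ τ :* k) :- p₊))
          :+ b₂ :* ((p :+ τ :* k) :- (p :+ (:- τ) :* k))
      := con two :* (b₀ :* (p :- p₋) :+ b₁ :* (p :- p₊)) :+ con two :* τ :* (k :* (b₀ :+ b₁ :+ b₂))) refl

    potential-kirchhoff : 1 ℕ.≤ n → ∀ u v w → Lap S (potential u v) w ≡ δ u w - δ v w
    potential-kirchhoff n≥1 u@(b₁ , i₁) v@(b₂ , i₂) (a , i) = begin
        Lap S x (a , i)
      ≡⟨ neighbourhood-sum S a i (λ w → x (a , i) - x w) G (column-pair u v (x (a , i))) ⟩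
        [ not (k ≡ᵇ 0) ] * G (k ∸ 1) + [ k <ᵇ n ] * G (suc k) + [ not s ] * (x (a , i) - x (not a , i))
      ≡⟨ cong (λ y → [ not (k ≡ᵇ 0) ] * G (k ∸ 1) + [ k <ᵇ n ] * G (suc k) + [ not s ] * (x (a , i) - y))
              (rung-partner u v a i) ⟩
        [ not (k ≡ᵇ 0) ] * G (k ∸ 1) + [ k <ᵇ n ] * G (suc k)
          + [ not s ] * (x (a , i) - (drift u v k + (- τ) * κ i))
      ≡⟨ laplacian-split [ not (k ≡ᵇ 0) ] [ k <ᵇ n ] [ not s ] (drift u v k) (drift u v (k ∸ 1)) (drift u v (suc k)) τ (κ i) ⟩
        two * pathLaplacian n (drift u v) k + two * τ * (κ i * ([ not (k ≡ᵇ 0) ] + [ k <ᵇ n ] + [ not s ]))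
      ≡⟨ cong₂ (λ A B → two * A + two * τ * B)
               (trans (pathLaplacian-linear n (dist (toℕ i₂)) (dist (toℕ i₁)) eighth k)
                      (cong₂ (λ A B → (A - B) * eighth) (pathLaplacian-dist n (toℕ i₂) k n≥1 (bound i₂) (bound i))
                                                        (pathLaplacian-dist n (toℕ i₁) k n≥1 (bound i₁) (bound i))))
               (columnWeight-balance n k s n≥1 (bound i)) ⟩
        two * (((- two * [ k ≡ᵇ toℕ i₂ ] + first + last) - (- two * [ k ≡ᵇ toℕ i₁ ] + first + last)) * eighth)
          + two * τ * quarter
      ≡⟨ solve 6 (λ e₁ e₂ z₀ zₙ σ₁ σ₂ →
             con two :* (((con (- two) :* e₂ :+ z₀ :+ zₙ) :- (con (- two) :* e₁ :+ z₀ :+ zₙ)) :* con eighth)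
               :+ con two :* (σ₁ :- σ₂) :* con quarter
           := (e₁ :+ σ₁) :* con half :- (e₂ :+ σ₂) :* con half)
           refl [ k ≡ᵇ toℕ i₁ ] [ k ≡ᵇ toℕ i₂ ] first last (σ u (a , i)) (σ v (a , i)) ⟩
        ([ k ≡ᵇ toℕ i₁ ] + σ u (a , i)) * half - ([ k ≡ᵇ toℕ i₂ ] + σ v (a , i)) * half
      ≡⟨ sym (cong₂ _-_ (δ-as-σ u a i) (δ-as-σ v a i)) ⟩
        δ u (a , i) - δ v (a , i)
      ∎
      where
      open ≡-Reasoning
      x : V n → ℚ
      x = potential u v
      k : ℕ
      k = toℕ i
      s : Bool
      s = lookup S i
      τ first last : ℚ
      τ = σ u (a , i) - σ v (a , i)
      first = [ k ≡ᵇ 0 ]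
      last = [ k ≡ᵇ n ]
      bound : (j : Fin (suc n)) → toℕ j ℕ.≤ n
      bound = FinP.toℕ≤pred[n]
      G : ℕ → ℚ
      G m = two * (x (a , i) - drift u v m)

    resistance : V n → V n → ℚ
    resistance (a , i) (b , j) = dist (toℕ j) (toℕ i) * quarter + (1ℚ - σ (a , i) (b , j)) * (κ i + κ j)

    potential-difference : ∀ u v → potential u v u - potential u v v ≡ resistance u v
    potential-difference (b₁ , i₁) (b₂ , i₂) =
      difference-algebra (ι ∣ toℕ i₁ - toℕ i₂ ∣) (σ (b₁ , i₁) (b₂ , i₂)) (κ i₁) (κ i₂)
        refl (cong ι (ℕP.∣n-n∣≡0 (toℕ i₁))) (rungSign-self (toℕ i₁) b₁) (rungSign-sym (toℕ i₂) (toℕ i₁) b₂ b₁)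
        (cong ι (ℕP.∣n-n∣≡0 (toℕ i₂))) (cong ι (ℕP.∣-∣-comm (toℕ i₂) (toℕ i₁))) refl (rungSign-self (toℕ i₂) b₂)
      where
      -- The values of dist and σ at u and v, fed in as equations.
      difference-algebra : ∀ {x₁ x₂ x₃ x₄ y₁ y₂ y₃ y₄} d σ₁₂ k₁ k₂ →
        x₁ ≡ d → x₂ ≡ 0ℚ → y₁ ≡ 1ℚ → y₂ ≡ σ₁₂ → x₃ ≡ 0ℚ → x₄ ≡ d → y₃ ≡ σ₁₂ → y₄ ≡ 1ℚ →
        ((x₁ - x₂) * eighth + (y₁ - y₂) * k₁) - ((x₃ - x₄) * eighth + (y₃ - y₄) * k₂)
        ≡ d * quarter + (1ℚ - σ₁₂) * (k₁ + k₂)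
      difference-algebra d σ₁₂ k₁ k₂ refl refl refl refl refl refl refl refl =
        solve 4 (λ d σ k₁ k₂ → ((d :- con 0ℚ) :* con eighth :+ (con 1ℚ :- σ) :* k₁)
                                 :- ((con 0ℚ :- d) :* con eighth :+ (σ :- con 1ℚ) :* k₂)
                               := d :* con quarter :+ (con 1ℚ :- σ) :* (k₁ :+ k₂)) refl d σ₁₂ k₁ k₂

    resistance-fn : 1 ℕ.≤ n → ResistanceFn S resistance
    resistance-fn n≥1 u v = potential u v , potential-kirchhoff n≥1 u v , sym (potential-difference u v)

    resistance-sym : ∀ u v → resistance u v ≡ resistance v u
    resistance-sym (a , i) (b , j) =
      trans (cong₂ (λ d σ′ → ι d * quarter + (1ℚ - σ′) * (κ i + κ j))
                   (ℕP.∣-∣-comm (toℕ i) (toℕ j)) (rungSign-sym (toℕ i) (toℕ j) a b))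
            (cong (λ c → dist (toℕ i) (toℕ j) * quarter + (1ℚ - σ (b , j) (a , i)) * c) (+-comm (κ i) (κ j)))

    resistance-self : ∀ u → resistance u u ≡ 0ℚ
    resistance-self (a , i) =
      trans (cong₂ (λ d σ′ → ι d * quarter + (1ℚ - σ′) * (κ i + κ i)) (ℕP.∣n-n∣≡0 (toℕ i)) (rungSign-self (toℕ i) a))
            (solve 1 (λ c → con 0ℚ :* con quarter :+ (con 1ℚ :- con 1ℚ) :* c := con 0ℚ) refl (κ i + κ i))

  code-injective : ∀ {n} (u v : V n) → code u ≡ code v → u ≡ v
  code-injective (false , i) (false , j) e = cong (false ,_) (FinP.toℕ-injective e)
  code-injective {n} (true , i) (true , j) e =
    cong (true ,_) (FinP.toℕ-injective (ℕP.+-cancelˡ-≡ (suc n) (toℕ i) (toℕ j) e))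
  code-injective {n} (false , i) (true , j) e =
    ⊥-elim (ℕP.<⇒≱ (FinP.toℕ<n i) (subst (suc n ℕ.≤_) (sym e) (ℕP.m≤m+n (suc n) (toℕ j))))
  code-injective {n} (true , i) (false , j) e =
    ⊥-elim (ℕP.<⇒≱ (FinP.toℕ<n j) (subst (suc n ℕ.≤_) e (ℕP.m≤m+n (suc n) (toℕ i))))

  split-at-diagonal : ∀ {n} (g : V n → V n → ℚ) → (∀ u → g u u ≡ 0ℚ) → ∀ u v →
    g u v ≡ (if code u <ᵇ code v then g u v else 0ℚ) + (if code v <ᵇ code u then g u v else 0ℚ)
  split-at-diagonal g g-diag u v with ℕP.<-cmp (code u) (code v)
  ... | tri< u<v _ _ rewrite <ᵇ-true (code u) (code v) u<v | <ᵇ-false (code v) (code u) (ℕP.<⇒≤ u<v) =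
    sym (+-identityʳ (g u v))
  ... | tri> _ _ u>v rewrite <ᵇ-true (code v) (code u) u>v | <ᵇ-false (code u) (code v) (ℕP.<⇒≤ u>v) =
    sym (+-identityˡ (g u v))
  ... | tri≈ _ e _ with code-injective u v e
  ...   | refl rewrite <ᵇ-false (code u) (code u) ℕP.≤-refl = g-diag u

  double-sum-Kf : ∀ {n} (g : V n → V n → ℚ) → (∀ u v → g u v ≡ g v u) → (∀ u → g u u ≡ 0ℚ) →
    ΣV (λ u → ΣV (λ v → g u v)) ≡ Kf g + Kf g
  double-sum-Kf {n} g g-sym g-diag = begin
      ΣV (λ u → ΣV (λ v → g u v))
    ≡⟨ ΣV-cong (λ u → trans (ΣV-cong (split-at-diagonal g g-diag u)) (ΣV-+ (below u) (above u))) ⟩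
      ΣV (λ u → ΣV (below u) + ΣV (above u))
    ≡⟨ ΣV-+ (λ u → ΣV (below u)) (λ u → ΣV (above u)) ⟩
      Kf g + ΣV (λ u → ΣV (above u))
    ≡⟨ cong (Kf g +_) (trans (ΣV-swap above)
                             (ΣV-cong (λ v → ΣV-cong (λ u → cong (if code v <ᵇ code u then_else 0ℚ) (g-sym u v))))) ⟩
      Kf g + Kf g
    ∎
    where
    open ≡-Reasoning
    below above : V n → V n → ℚ
    below u v = if code u <ᵇ code v then g u v else 0ℚ
    above u v = if code v <ᵇ code u then g u v else 0ℚ

  Kf-cong : ∀ {n} {ρ ρ′ : V n → V n → ℚ} → (∀ u v → ρ u v ≡ ρ′ u v) → Kf ρ ≡ Kf ρ′
  Kf-cong ρ≗ρ′ = ΣV-cong (λ u → ΣV-cong (λ v → cong (if code u <ᵇ code v then_else 0ℚ) (ρ≗ρ′ u v)))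

  triangular-sum : ∀ m → ΣFin {m} (λ j → ι (suc (toℕ j))) ≡ (ι m * ι m + ι m) * half
  triangular-sum zero = refl
  triangular-sum (suc m) =
    trans (cong (ι 1 +_) (trans (ΣFin-+ {m} (λ _ → 1ℚ) (λ j → ι (suc (toℕ j))))
                               (cong₂ _+_ (ΣFin-const m 1ℚ) (triangular-sum m))))
          (solve 1 (λ M → (con 1ℚ :+ con 0ℚ) :+ (M :* con 1ℚ :+ (M :* M :+ M) :* con half)
                       := ((con 1ℚ :+ M) :* (con 1ℚ :+ M) :+ (con 1ℚ :+ M)) :* con half) refl (ι m))

  distance-sum : ∀ m → ΣFin {m} (λ i → ΣFin {m} (λ j → ι ∣ toℕ i - toℕ j ∣)) ≡ (ι m * ι m * ι m - ι m) * third
  distance-sum zero = refl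
  distance-sum (suc m) =
    trans (cong₂ _+_ (cong (0ℚ +_) (triangular-sum m))
                     (trans (ΣFin-+ {m} (λ i → ι (suc (toℕ i))) (λ i → ΣFin {m} (λ j → ι ∣ toℕ i - toℕ j ∣)))
                            (cong₂ _+_ (triangular-sum m) (distance-sum m))))
          (solve 1 (λ M → (con 0ℚ :+ (M :* M :+ M) :* con half) :+ ((M :* M :+ M) :* con half :+ (M :* M :* M :- M) :* con third)
                       := ((con 1ℚ :+ M) :* (con 1ℚ :+ M) :* (con 1ℚ :+ M) :- (con 1ℚ :+ M)) :* con third) refl (ι m))

  -- Over the four row pairs of two columns the rung signs cancel.
  four-rows : ∀ e d k →
    ((d * quarter + (1ℚ - rungSign e false false) * k) + (d * quarter + (1ℚ - rungSign e false true) * k))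
      + ((d * quarter + (1ℚ - rungSign e true false) * k) + (d * quarter + (1ℚ - rungSign e true true) * k))
    ≡ d + four * k
  four-rows true = solve 2 (λ d k →
      ((d :* con quarter :+ (con 1ℚ :- con 1ℚ) :* k) :+ (d :* con quarter :+ (con 1ℚ :- con (- 1ℚ)) :* k))
        :+ ((d :* con quarter :+ (con 1ℚ :- con (- 1ℚ)) :* k) :+ (d :* con quarter :+ (con 1ℚ :- con 1ℚ) :* k))
      := d :+ con four :* k) refl
  four-rows false = solve 2 (λ d k →
      ((d :* con quarter :+ (con 1ℚ :- con 0ℚ) :* k) :+ (d :* con quarter :+ (con 1ℚ :- con 0ℚ) :* k))
        :+ ((d :* con quarter :+ (con 1ℚ :- con 0ℚ) :* k) :+ (d :* con quarter :+ (con 1ℚ :- con 0ℚ) :* k))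
      := d :+ con four :* k) refl

  endWeight : Bool → ℚ
  endWeight s = twentyfourth + [ s ] * twelfth

  inner-or-last-weight : ∀ e s →
    columnWeight e s ≡ twelfth + [ s ] * twentyfourth + 0ℚ * endWeight s + [ e ] * endWeight s
  inner-or-last-weight true true = refl
  inner-or-last-weight true false = refl
  inner-or-last-weight false true = refl
  inner-or-last-weight false false = refl

  columnWeight-split : ∀ n k s → 1 ℕ.≤ n →
    columnWeight ((k ≡ᵇ 0) ∨ (k ≡ᵇ n)) s
      ≡ twelfth + [ s ] * twentyfourth + [ k ≡ᵇ 0 ] * endWeight s + [ k ≡ᵇ n ] * endWeight s
  columnWeight-split (suc n) zero true _ = refl
  columnWeight-split (suc n) zero false _ = refl
  columnWeight-split (suc n) (suc k) s _ = inner-or-last-weight (k ≡ᵇ n) s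

  formulaℚ : ℚ → ℚ → ℚ → ℚ
  formulaℚ N R D = (1ℚ + N) * (N * N + ι 4 * N + R - two * D + ι 16) * sixth

  difference-over-six : ∀ A B → (ℤ.+ A ℤ.- ℤ.+ B) / 6 ≡ (ι A - ι B) * sixth
  difference-over-six A B = trans (fromℚᵘ-cong as-unnormalised) (fromℚᵘ-toℚᵘ ((ι A - ι B) * sixth))
    where
    ι-unnormalised : ∀ m → toℚᵘ (ι m) ℚᵘ.≃ mkℚᵘ (ℤ.+ m) 0
    ι-unnormalised zero = ℚᵘP.≃-refl
    ι-unnormalised (suc m) = ℚᵘP.≃-trans (toℚᵘ-homo-+ 1ℚ (ι m))
      (ℚᵘP.≃-trans (ℚᵘP.+-cong (ℚᵘP.≃-refl {toℚᵘ 1ℚ}) (ι-unnormalised m))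
                   (*≡* (trans (ℤP.*-identityʳ _)
                        (trans (cong (ℤ._+_ (ℤ.+ 1)) (ℤP.*-identityʳ (ℤ.+ m)))
                        (trans (sym (ℤP.pos-+ 1 m)) (sym (ℤP.*-identityʳ (ℤ.+ suc m))))))))
    as-unnormalised : mkℚᵘ (ℤ.+ A ℤ.- ℤ.+ B) 5 ℚᵘ.≃ toℚᵘ ((ι A - ι B) * sixth)
    as-unnormalised = ℚᵘP.≃-sym (ℚᵘP.≃-trans (toℚᵘ-homo-* (ι A - ι B) sixth)
      (ℚᵘP.≃-trans (ℚᵘP.*-cong (ℚᵘP.≃-trans (toℚᵘ-homo-+ (ι A) (- ι B))
                                             (ℚᵘP.+-cong (ι-unnormalised A) (ℚᵘP.≃-trans (toℚᵘ-homo‿- (ι B)) (ℚᵘP.-‿cong (ι-unnormalised B)))))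
                               (ℚᵘP.≃-refl {toℚᵘ sixth}))
        (*≡* (cong (ℤ._* ℤ.+ 6) (trans (ℤP.*-identityʳ _)
                                  (cong₂ ℤ._+_ (ℤP.*-identityʳ (ℤ.+ A)) (ℤP.*-identityʳ (ℤ.- ℤ.+ B))))))))

  formula-as-ℚ : ∀ n r d → formula n r d ≡ formulaℚ (ι n) (ι r) (ι d)
  formula-as-ℚ n r d = begin
      formula n r d
    ≡⟨ difference-over-six (suc n ℕ.* (n ℕ.* n ℕ.+ 4 ℕ.* n ℕ.+ r ℕ.+ 16)) (suc n ℕ.* (2 ℕ.* d)) ⟩
      (ι (suc n ℕ.* (n ℕ.* n ℕ.+ 4 ℕ.* n ℕ.+ r ℕ.+ 16)) - ι (suc n ℕ.* (2 ℕ.* d))) * sixth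
    ≡⟨ cong₂ (λ A B → (A - B) * sixth) positive-part negative-part ⟩
      ((1ℚ + N) * (N * N + ι 4 * N + R + ι 16) - (1ℚ + N) * (ι 2 * D)) * sixth
    ≡⟨ solve 3 (λ N R D → ((con 1ℚ :+ N) :* (N :* N :+ con (ι 4) :* N :+ R :+ con (ι 16)) :- (con 1ℚ :+ N) :* (con (ι 2) :* D)) :* con sixth
                       := (con 1ℚ :+ N) :* (N :* N :+ con (ι 4) :* N :+ R :- con two :* D :+ con (ι 16)) :* con sixth)
               refl N R D ⟩
      formulaℚ N R D
    ∎
    where
    open ≡-Reasoning
    N R D : ℚ
    N = ι n
    R = ι r
    D = ι d
    positive-part : ι (suc n ℕ.* (n ℕ.* n ℕ.+ 4 ℕ.* n ℕ.+ r ℕ.+ 16)) ≡ (1ℚ + N) * (N * N + ι 4 * N + R + ι 16)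
    positive-part = trans (ι-* (suc n) (n ℕ.* n ℕ.+ 4 ℕ.* n ℕ.+ r ℕ.+ 16))
      (cong ((1ℚ + N) *_) (trans (ι-+ (n ℕ.* n ℕ.+ 4 ℕ.* n ℕ.+ r) 16)
      (cong (_+ ι 16) (trans (ι-+ (n ℕ.* n ℕ.+ 4 ℕ.* n) r)
      (cong (_+ R) (trans (ι-+ (n ℕ.* n) (4 ℕ.* n)) (cong₂ _+_ (ι-* n n) (ι-* 4 n))))))))
    negative-part : ι (suc n ℕ.* (2 ℕ.* d)) ≡ (1ℚ + N) * (ι 2 * D)
    negative-part = trans (ι-* (suc n) (2 ℕ.* d)) (cong ((1ℚ + N) *_) (ι-* 2 d))

  module Totals {n : ℕ} (S : Subset (suc n)) where
    open Potential S

    κ-total : 1 ℕ.≤ n → ΣFin κ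
      ≡ ι (suc n) * twelfth + ι (card S) * twentyfourth + endWeight (lookup S fzero) + endWeight (lookup S (fromℕ n))
    κ-total n≥1 = begin
        ΣFin κ
      ≡⟨ ΣFin-cong (λ i → columnWeight-split n (toℕ i) (lookup S i) n≥1) ⟩
        ΣFin (λ i → base i + [ toℕ i ≡ᵇ 0 ] * Y i + [ toℕ i ≡ᵇ n ] * Y i)
      ≡⟨ ΣFin-+ (λ i → base i + [ toℕ i ≡ᵇ 0 ] * Y i) (λ i → [ toℕ i ≡ᵇ n ] * Y i) ⟩
        ΣFin (λ i → base i + [ toℕ i ≡ᵇ 0 ] * Y i) + ΣFin (λ i → [ toℕ i ≡ᵇ n ] * Y i)
      ≡⟨ cong₂ _+_ (ΣFin-+ base (λ i → [ toℕ i ≡ᵇ 0 ] * Y i)) last-column ⟩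
        ΣFin base + ΣFin (λ i → [ toℕ i ≡ᵇ 0 ] * Y i) + Y (fromℕ n)
      ≡⟨ cong (_+ Y (fromℕ n)) (cong₂ _+_ base-total first-column) ⟩
        ι (suc n) * twelfth + ι (card S) * twentyfourth + Y fzero + Y (fromℕ n)
      ∎
      where
      open ≡-Reasoning
      base Y : Fin (suc n) → ℚ
      base i = twelfth + [ lookup S i ] * twentyfourth
      Y i = endWeight (lookup S i)
      base-total : ΣFin base ≡ ι (suc n) * twelfth + ι (card S) * twentyfourth
      base-total = trans (ΣFin-+ (λ _ → twelfth) (λ i → [ lookup S i ] * twentyfourth))
        (cong₂ _+_ (ΣFin-const (suc n) twelfth)
                   (trans (ΣFin-*ʳ (λ i → [ lookup S i ]) twentyfourth) (cong (_* twentyfourth) (ΣFin-count S))))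
      first-column : ΣFin (λ i → [ toℕ i ≡ᵇ 0 ] * Y i) ≡ Y fzero
      first-column = trans (ΣFin-cong (λ i → trans (sym (if-as-bracket (toℕ i ≡ᵇ 0) (Y i)))
                                                   (cong (if_then Y i else 0ℚ) (≡ᵇ-sym (toℕ i) 0))))
                           (ΣFin-pick fzero Y)
      last-column : ΣFin (λ i → [ toℕ i ≡ᵇ n ] * Y i) ≡ Y (fromℕ n)
      last-column = trans (ΣFin-cong (λ i → trans (sym (if-as-bracket (toℕ i ≡ᵇ n) (Y i)))
                                                  (cong (if_then Y i else 0ℚ)
                                                        (trans (≡ᵇ-sym (toℕ i) n) (cong (_≡ᵇ toℕ i) (sym (FinP.toℕ-fromℕ n)))))))
                          (ΣFin-pick (fromℕ n) Y)

    distances : ℚ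
    distances = ΣFin {suc n} (λ i → ΣFin {suc n} (λ j → ι ∣ toℕ i - toℕ j ∣))

    weight-total : ΣFin (λ i → ΣFin (λ j → four * (κ i + κ j))) ≡ four * (ι (suc n) * ΣFin κ + ι (suc n) * ΣFin κ)
    weight-total = begin
        ΣFin (λ i → ΣFin (λ j → four * (κ i + κ j)))
      ≡⟨ ΣFin-cong (λ i → trans (ΣFin-*ˡ four (λ j → κ i + κ j))
                                (cong (four *_) (trans (ΣFin-+ (λ _ → κ i) κ) (cong (_+ ΣFin κ) (ΣFin-const (suc n) (κ i)))))) ⟩
        ΣFin (λ i → four * (ι (suc n) * κ i + ΣFin κ))
      ≡⟨ ΣFin-*ˡ four (λ i → ι (suc n) * κ i + ΣFin κ) ⟩
        four * ΣFin (λ i → ι (suc n) * κ i + ΣFin κ)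
      ≡⟨ cong (four *_) (trans (ΣFin-+ (λ i → ι (suc n) * κ i) (λ _ → ΣFin κ))
                               (cong₂ _+_ (ΣFin-*ˡ (ι (suc n)) κ) (ΣFin-const (suc n) (ΣFin κ)))) ⟩
        four * (ι (suc n) * ΣFin κ + ι (suc n) * ΣFin κ)
      ∎
      where open ≡-Reasoning

    resistance-total : ΣV (λ u → ΣV (λ v → resistance u v))
      ≡ distances + four * (ι (suc n) * ΣFin κ + ι (suc n) * ΣFin κ)
    resistance-total = begin
        ΣV (λ u → ΣV (λ v → resistance u v))
      ≡⟨ cong₂ _+_ (ΣFin-cong (λ i → sym (ΣFin-+ (λ j → resistance (false , i) (false , j)) (λ j → resistance (false , i) (true , j)))))
                   (ΣFin-cong (λ i → sym (ΣFin-+ (λ j → resistance (true , i) (false , j)) (λ j → resistance (true , i) (true , j))))) ⟩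
        ΣFin (λ i → ΣFin (rows false i)) + ΣFin (λ i → ΣFin (rows true i))
      ≡⟨ sym (ΣFin-+ (λ i → ΣFin (rows false i)) (λ i → ΣFin (rows true i))) ⟩
        ΣFin (λ i → ΣFin (rows false i) + ΣFin (rows true i))
      ≡⟨ ΣFin-cong (λ i → trans (sym (ΣFin-+ (rows false i) (rows true i)))
                                (ΣFin-cong (λ j → four-rows (toℕ i ≡ᵇ toℕ j) (ι ∣ toℕ i - toℕ j ∣) (κ i + κ j)))) ⟩
        ΣFin (λ i → ΣFin (λ j → ι ∣ toℕ i - toℕ j ∣ + four * (κ i + κ j)))
      ≡⟨ trans (ΣFin-cong (λ i → ΣFin-+ (λ j → ι ∣ toℕ i - toℕ j ∣) (λ j → four * (κ i + κ j))))
               (ΣFin-+ (λ i → ΣFin {suc n} (λ j → ι ∣ toℕ i - toℕ j ∣)) (λ i → ΣFin (λ j → four * (κ i + κ j)))) ⟩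
        distances + ΣFin (λ i → ΣFin (λ j → four * (κ i + κ j)))
      ≡⟨ cong (distances +_) weight-total ⟩
        distances + four * (ι (suc n) * ΣFin κ + ι (suc n) * ΣFin κ)
      ∎
      where
      open ≡-Reasoning
      rows : Bool → Fin (suc n) → Fin (suc n) → ℚ
      rows a i j = resistance (a , i) (false , j) + resistance (a , i) (true , j)

    end-degrees : 1 ℕ.≤ n →
      ι (deg S v1 ℕ.+ deg S vlast) ≡ (two + (1ℚ - [ lookup S fzero ])) + (two + (1ℚ - [ lookup S (fromℕ n) ]))
    end-degrees n≥1 = trans (ι-+ (deg S v1) (deg S vlast))
      (cong₂ _+_ (trans (degree-first S n≥1) (cong (two +_) (bracket-not (lookup S fzero))))
                 (trans (degree-last S n≥1) (cong (two +_) (bracket-not (lookup S (fromℕ n))))))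

    Kf-resistance : 1 ℕ.≤ n → Kf resistance ≡ formulaℚ (ι n) (ι (card S)) (ι (deg S v1 ℕ.+ deg S vlast))
    Kf-resistance n≥1 = begin
        Kf resistance
      ≡⟨ solve 1 (λ k → k := (k :+ k) :* con half) refl (Kf resistance) ⟩
        (Kf resistance + Kf resistance) * half
      ≡⟨ cong (_* half) (sym (double-sum-Kf resistance resistance-sym resistance-self)) ⟩
        ΣV (λ u → ΣV (λ v → resistance u v)) * half
      ≡⟨ cong (_* half) (trans resistance-total (cong₂ (λ A K → A + four * (M * K + M * K)) (distance-sum (suc n)) (κ-total n≥1))) ⟩
        ((M * M * M - M) * third + four * (M * K + M * K)) * half
      ≡⟨ solve 4 (λ N R s₀ sₙ →
             (((con 1ℚ :+ N) :* (con 1ℚ :+ N) :* (con 1ℚ :+ N) :- (con 1ℚ :+ N)) :* con third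
               :+ con four :* ((con 1ℚ :+ N) :* Kₑ N R s₀ sₙ :+ (con 1ℚ :+ N) :* Kₑ N R s₀ sₙ)) :* con half
           := (con 1ℚ :+ N) :* (N :* N :+ con (ι 4) :* N :+ R
                                 :- con two :* ((con two :+ (con 1ℚ :- s₀)) :+ (con two :+ (con 1ℚ :- sₙ))) :+ con (ι 16))
                             :* con sixth)
           refl (ι n) (ι (card S)) [ s₀ ] [ sₙ ] ⟩
        formulaℚ (ι n) (ι (card S)) ((two + (1ℚ - [ s₀ ])) + (two + (1ℚ - [ sₙ ])))
      ≡⟨ cong (formulaℚ (ι n) (ι (card S))) (sym (end-degrees n≥1)) ⟩
        formulaℚ (ι n) (ι (card S)) (ι (deg S v1 ℕ.+ deg S vlast))
      ∎
      where
      open ≡-Reasoning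
      s₀ sₙ : Bool
      s₀ = lookup S fzero
      sₙ = lookup S (fromℕ n)
      M K : ℚ
      M = ι (suc n)
      K = M * twelfth + ι (card S) * twentyfourth + endWeight s₀ + endWeight sₙ
      Kₑ = λ N R s₀ sₙ → (con 1ℚ :+ N) :* con twelfth :+ R :* con twentyfourth
                          :+ (con twentyfourth :+ s₀ :* con twelfth) :+ (con twentyfourth :+ sₙ :* con twelfth)

open import Defs
open import Data.Nat using (ℕ; suc; _≤_; _+_)
open import Data.Fin.Subset using (Subset; ∣_∣)
open import Data.Rational using (ℚ)
open import Data.Product using (Σ; _×_; _,_)
open import Relation.Binary.PropositionalEquality using (_≡_; refl; sym; module ≡-Reasoning)
open Resistance

-- The resistance function exists (explicit potentials) and any resistance
-- function agrees with it (reciprocity), so its Kirchhoff index is the formula.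
theorem4p2 : (n r : ℕ) → 1 ≤ n → r ≤ suc n → (S : Subset (suc n)) → ∣ S ∣ ≡ r →
    Σ (V n → V n → ℚ) (ResistanceFn S) ×
    ((ρ : V n → V n → ℚ) → ResistanceFn S ρ →
      Kf ρ ≡ formula n r (deg S v1 + deg S vlast))
theorem4p2 n r n≥1 _ S refl = (resistance , resistance-fn n≥1) , Kf-is-formula
  where
  open Potential S
  open Totals S
  open ≡-Reasoning
  Kf-is-formula : (ρ : V n → V n → ℚ) → ResistanceFn S ρ → Kf ρ ≡ formula n ∣ S ∣ (deg S v1 + deg S vlast)
  Kf-is-formula ρ ρ-fn = begin
      Kf ρ
    ≡⟨ Kf-cong (λ u v → resistance-unique S (ρ-fn u v) (resistance-fn n≥1 u v)) ⟩
      Kf resistance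
    ≡⟨ Kf-resistance n≥1 ⟩
      formulaℚ (ι n) (ι ∣ S ∣) (ι (deg S v1 + deg S vlast))
    ≡⟨ sym (formula-as-ℚ n ∣ S ∣ (deg S v1 + deg S vlast)) ⟩
      formula n ∣ S ∣ (deg S v1 + deg S vlast)
    ∎
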